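{- For positive integers $n,r,s$, \begin{align*} U_{n+r}U_{n+s}-U_{n}U_{n+r+s}&=(-q)^{n}u_{r}\left(U_{1}U_{s}-U_{0}U_{s+1}\right),\\ U_{n+r}W_{n+s}-U_{n}W_{n+r+s}&=(-q)^{n}u_{r}\left(U_{1}W_{s}-U_{0}W_{s+1}\right),\\ W_{n+r}U_{n+s}-W_{n}U_{n+r+s}&=(-q)^{n}u_{r}\left(W_{1}U_{s}-W_{0}U_{s+1}\right),\\ W_{n+r}W_{n+s}-W_{n}W_{n+r+s}&=(-q)^{n}u_{r}\left(W_{1}W_{s}-W_{0}W_{s+1}\right). \end{align*}
   Context: Let $H$ be the real quaternion algebra with basis $1,i,j,k$ and (non-commutative) multiplication determined by $i^2=j^2=k^2=-1$, $ij=-ji=k$, $jk=-kj=i$, $ki=-ik=j$; real scalars commute with all quaternions. Fix real numbers $p,q$. The Horadam sequence $w_n=w_n(w_0,w_1;p,q)$ has real initial values $w_0,w_1$ and satisfies $w_n=pw_{n-1}+qw_{n-2}$ for $n\ge 2$. Let $u_n=w_n(0,1;p,q)$ (the $(p,q)$-Fibonacci numbers). The Horadam quaternions are $W_n=w_n+w_{n+1}i+w_{n+2}j+w_{n+3}k$, and the $(p,q)$-Fibonacci quaternions are $U_n=u_n+u_{n+1}i+u_{n+2}j+u_{n+3}k$. -}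

module Defs where

open import Level using (_⊔_)
open import Algebra.Bundles using (CommutativeRing)
open import Data.Nat using (ℕ; zero; suc)
open import Data.Product using (_×_)

-- Everything is developed over an arbitrary commutative ring R of scalars
-- (the paper uses R = ℝ; agda-stdlib has no real numbers).
module Quat {c ℓ} (R : CommutativeRing c ℓ) where
  open CommutativeRing R

  pow : Carrier → ℕ → Carrier
  pow x zero    = 1#
  pow x (suc n) = x * pow x n

  record H : Set c where
    constructor quat
    field
      re ci cj ck : Carrier
  open H public

  _≈H_ : H → H → Set ℓ
  x ≈H y = (re x ≈ re y) × (ci x ≈ ci y) × (cj x ≈ cj y) × (ck x ≈ ck y)

  infixl 6 _+H_ _-H_
  infixl 7 _*H_ _·H_

  _+H_ : H → H → H
  quat a b c' d +H quat e f g h = quat (a + e) (b + f) (c' + g) (d + h)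

  _-H_ : H → H → H
  quat a b c' d -H quat e f g h = quat (a - e) (b - f) (c' - g) (d - h)

  _·H_ : Carrier → H → H
  t ·H quat a b c' d = quat (t * a) (t * b) (t * c') (t * d)

  -- Hamilton product (i² = j² = k² = -1, ij = k, jk = i, ki = j)
  _*H_ : H → H → H
  quat a1 b1 c1 d1 *H quat a2 b2 c2 d2 =
    quat (a1 * a2 - b1 * b2 - c1 * c2 - d1 * d2)
         (a1 * b2 + b1 * a2 + c1 * d2 - d1 * c2)
         (a1 * c2 - b1 * d2 + c1 * a2 + d1 * b2)
         (a1 * d2 + b1 * c2 - c1 * b2 + d1 * a2)

  horadam : (w0 w1 p q : Carrier) → ℕ → Carrier
  horadam w0 w1 p q zero          = w0
  horadam w0 w1 p q (suc zero)    = w1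
  horadam w0 w1 p q (suc (suc n)) =
    p * horadam w0 w1 p q (suc n) + q * horadam w0 w1 p q n

  fib : (p q : Carrier) → ℕ → Carrier
  fib p q = horadam 0# 1# p q

  horadamQ : (w0 w1 p q : Carrier) → ℕ → H
  horadamQ w0 w1 p q n =
    quat (horadam w0 w1 p q n) (horadam w0 w1 p q (suc n))
         (horadam w0 w1 p q (suc (suc n))) (horadam w0 w1 p q (suc (suc (suc n))))

  fibQ : (p q : Carrier) → ℕ → H
  fibQ p q = horadamQ 0# 1# p q

module Submission where

-- Let X, Y be any two quaternion sequences obeying the Horadam recurrence
-- Z (n+2) = p Z (n+1) + q Z n.  The whole argument uses only that the
-- Hamilton product is bilinear over the (commutative) scalars, never its
-- non-commutativity, which is why the four identities of the corollary are
-- all instances of a single statement about such a pair (X , Y):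
--
--   1. every term of the recurrence is a fixed combination of two
--      consecutive ones:  Z (m + r+1) = u (r+1) Z (m+1) + q u r Z m;
--   2. the "Casoratian"  C n = X (n+1) Y (n+s) - X n Y (n+s+1)  satisfies
--      C (n+1) = (-q) C n, hence C n = (-q)^n C 0;
--   3. substituting 1. into the left-hand side and using bilinearity turns
--      it into  u (r+1) C n,  which by 2. is the right-hand side.

open import Defs
open import Level using (Level)
open import Algebra.Bundles using (CommutativeRing)
import Data.Nat.Properties as ℕ
import Algebra.Properties.CommutativeSemigroup as CommSemigroupProperties
open import Data.Product using (_×_; _,_)
open import Relation.Binary.Bundles using (Setoid)
open import Relation.Binary.PropositionalEquality using (cong)

module ScalarIdentities {c ℓ} (R : CommutativeRing c ℓ) where
  open CommutativeRing R
  open import Algebra.Properties.Ring ring using (-‿distribˡ-*; -‿distribʳ-*)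
  open import Algebra.Properties.AbelianGroup +-abelianGroup
    using (⁻¹-∙-comm; ⁻¹-anti-homo‿-)
  open CommSemigroupProperties +-commutativeSemigroup using (interchange; xy∙z≈xz∙y)
  open CommSemigroupProperties *-commutativeSemigroup using (x∙yz≈y∙xz)
  open import Relation.Binary.Reasoning.Setoid setoid

  *-linearˡ : ∀ a b x y z → (a * x + b * y) * z ≈ a * (x * z) + b * (y * z)
  *-linearˡ a b x y z =
    trans (distribʳ z (a * x) (b * y)) (+-cong (*-assoc a x z) (*-assoc b y z))

  *-linearʳ : ∀ a b x y z → x * (a * y + b * z) ≈ a * (x * y) + b * (x * z)
  *-linearʳ a b x y z =
    trans (distribˡ x (a * y) (b * z)) (+-cong (x∙yz≈y∙xz x a y) (x∙yz≈y∙xz x b z))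

  -- Sums and differences of combinations a·_ + b·_ are again such
  -- combinations; stated for arbitrary proofs so that a whole Hamilton
  -- component can be assembled from its sixteen products.
  combine-+ : ∀ {a b x y p q p′ q′} →
    x ≈ a * p + b * q → y ≈ a * p′ + b * q′ → x + y ≈ a * (p + p′) + b * (q + q′)
  combine-+ {a} {b} {p = p} {q} {p′} {q′} x≈ y≈ = begin
    _ + _                             ≈⟨ +-cong x≈ y≈ ⟩
    (a * p + b * q) + (a * p′ + b * q′) ≈⟨ interchange _ _ _ _ ⟩
    (a * p + a * p′) + (b * q + b * q′) ≈⟨ +-cong (distribˡ a p p′) (distribˡ b q q′) ⟨
    a * (p + p′) + b * (q + q′)       ∎

  combine-− : ∀ {a b x y p q p′ q′} →
    x ≈ a * p + b * q → y ≈ a * p′ + b * q′ → x - y ≈ a * (p - p′) + b * (q - q′)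
  combine-− {a} {b} {p′ = p′} {q′} x≈ y≈ = combine-+ x≈ (begin
    - _                        ≈⟨ -‿cong y≈ ⟩
    - (a * p′ + b * q′)        ≈⟨ ⁻¹-∙-comm (a * p′) (b * q′) ⟨
    - (a * p′) + - (b * q′)    ≈⟨ +-cong (-‿distribʳ-* a p′) (-‿distribʳ-* b q′) ⟩
    a * (- p′) + b * (- q′)    ∎)

  -- The combination with coefficients u₁ = 1 and q·u₀ = 0 is trivial.
  unit-combination : ∀ t x y → 1# * x + (t * 0#) * y ≈ x
  unit-combination t x y = begin
    1# * x + (t * 0#) * y ≈⟨ +-cong (*-identityˡ x) (trans (*-congʳ (zeroʳ t)) (zeroˡ y)) ⟩
    x + 0#                ≈⟨ +-identityʳ x ⟩
    x                     ∎

  combination-step : ∀ a b p q x y →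
    a * (p * x + q * y) + (q * b) * x ≈ (p * a + q * b) * x + (q * a) * y
  combination-step a b p q x y = begin
    a * (p * x + q * y) + (q * b) * x
      ≈⟨ +-congʳ (trans (*-linearʳ p q a x y) (+-cong (sym (*-assoc p a x)) (sym (*-assoc q a y)))) ⟩
    ((p * a) * x + (q * a) * y) + (q * b) * x ≈⟨ xy∙z≈xz∙y _ _ _ ⟩
    ((p * a) * x + (q * b) * x) + (q * a) * y ≈⟨ +-congʳ (distribʳ x (p * a) (q * b)) ⟨
    (p * a + q * b) * x + (q * a) * y         ∎

  cancel-first : ∀ a b P Q R → (a * P + b * Q) - (a * P + b * R) ≈ (- b) * (R - Q)
  cancel-first a b P Q R = begin
    (a * P + b * Q) - (a * P + b * R) ≈⟨ combine-− refl refl ⟩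
    a * (P - P) + b * (Q - R)         ≈⟨ +-congʳ (trans (*-congˡ (-‿inverseʳ P)) (zeroʳ a)) ⟩
    0# + b * (Q - R)                  ≈⟨ +-identityˡ _ ⟩
    b * (Q - R)                       ≈⟨ *-congˡ (⁻¹-anti-homo‿- R Q) ⟨
    b * (- (R - Q))                   ≈⟨ -‿distribʳ-* b (R - Q) ⟨
    - (b * (R - Q))                   ≈⟨ -‿distribˡ-* b (R - Q) ⟩
    (- b) * (R - Q)                   ∎

  cancel-second : ∀ a b P Q R → (a * P + b * Q) - (a * R + b * Q) ≈ a * (P - R)
  cancel-second a b P Q R = begin
    (a * P + b * Q) - (a * R + b * Q) ≈⟨ combine-− refl refl ⟩
    a * (P - R) + b * (Q - Q)         ≈⟨ +-congˡ (trans (*-congˡ (-‿inverseʳ Q)) (zeroʳ b)) ⟩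
    a * (P - R) + 0#                  ≈⟨ +-identityʳ _ ⟩
    a * (P - R)                       ∎

module QuaternionAlgebra {c ℓ} (R : CommutativeRing c ℓ) where
  open CommutativeRing R
  open Quat R
  private module S = ScalarIdentities R
  open S using () renaming (combine-+ to _⊕_; combine-− to _⊖_)

  ≈H-setoid : Setoid c ℓ
  ≈H-setoid = record
    { Carrier = H
    ; _≈_ = _≈H_
    ; isEquivalence = record
      { refl  = refl , refl , refl , refl
      ; sym   = λ (e₀ , e₁ , e₂ , e₃) → sym e₀ , sym e₁ , sym e₂ , sym e₃
      ; trans = λ (e₀ , e₁ , e₂ , e₃) (f₀ , f₁ , f₂ , f₃) →
                  trans e₀ f₀ , trans e₁ f₁ , trans e₂ f₂ , trans e₃ f₃
      }
    }

  −-cong : ∀ {x y u v} → x ≈ y → u ≈ v → x - u ≈ y - v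
  −-cong x≈y u≈v = +-cong x≈y (-‿cong u≈v)

  +H-cong : ∀ {X Y Z W} → X ≈H Y → Z ≈H W → (X +H Z) ≈H (Y +H W)
  +H-cong (e₀ , e₁ , e₂ , e₃) (f₀ , f₁ , f₂ , f₃) =
    +-cong e₀ f₀ , +-cong e₁ f₁ , +-cong e₂ f₂ , +-cong e₃ f₃

  -H-cong : ∀ {X Y Z W} → X ≈H Y → Z ≈H W → (X -H Z) ≈H (Y -H W)
  -H-cong (e₀ , e₁ , e₂ , e₃) (f₀ , f₁ , f₂ , f₃) =
    −-cong e₀ f₀ , −-cong e₁ f₁ , −-cong e₂ f₂ , −-cong e₃ f₃

  ·H-cong : ∀ {a b X Y} → a ≈ b → X ≈H Y → (a ·H X) ≈H (b ·H Y)
  ·H-cong a≈b (e₀ , e₁ , e₂ , e₃) =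
    *-cong a≈b e₀ , *-cong a≈b e₁ , *-cong a≈b e₂ , *-cong a≈b e₃

  *H-cong : ∀ {X Y Z W} → X ≈H Y → Z ≈H W → (X *H Z) ≈H (Y *H W)
  *H-cong (a , b , c′ , d) (e , f , g , h) =
      −-cong (−-cong (−-cong (*-cong a e) (*-cong b f)) (*-cong c′ g)) (*-cong d h)
    , −-cong (+-cong (+-cong (*-cong a f) (*-cong b e)) (*-cong c′ h)) (*-cong d g)
    , +-cong (+-cong (−-cong (*-cong a g) (*-cong b h)) (*-cong c′ e)) (*-cong d f)
    , +-cong (−-cong (+-cong (*-cong a h) (*-cong b g)) (*-cong c′ f)) (*-cong d e)

  *H-linearˡ : ∀ a b X Y Z →
    ((a ·H X +H b ·H Y) *H Z) ≈H (a ·H (X *H Z) +H b ·H (Y *H Z))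
  *H-linearˡ a b (quat x₀ x₁ x₂ x₃) (quat y₀ y₁ y₂ y₃) (quat z₀ z₁ z₂ z₃) =
      (((l x₀ y₀ z₀ ⊖ l x₁ y₁ z₁) ⊖ l x₂ y₂ z₂) ⊖ l x₃ y₃ z₃)
    , (((l x₀ y₀ z₁ ⊕ l x₁ y₁ z₀) ⊕ l x₂ y₂ z₃) ⊖ l x₃ y₃ z₂)
    , (((l x₀ y₀ z₂ ⊖ l x₁ y₁ z₃) ⊕ l x₂ y₂ z₀) ⊕ l x₃ y₃ z₁)
    , (((l x₀ y₀ z₃ ⊕ l x₁ y₁ z₂) ⊖ l x₂ y₂ z₁) ⊕ l x₃ y₃ z₀)
    where
    l : ∀ x y z → (a * x + b * y) * z ≈ a * (x * z) + b * (y * z)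
    l = S.*-linearˡ a b

  *H-linearʳ : ∀ a b X Y Z →
    (X *H (a ·H Y +H b ·H Z)) ≈H (a ·H (X *H Y) +H b ·H (X *H Z))
  *H-linearʳ a b (quat x₀ x₁ x₂ x₃) (quat y₀ y₁ y₂ y₃) (quat z₀ z₁ z₂ z₃) =
      (((r x₀ y₀ z₀ ⊖ r x₁ y₁ z₁) ⊖ r x₂ y₂ z₂) ⊖ r x₃ y₃ z₃)
    , (((r x₀ y₁ z₁ ⊕ r x₁ y₀ z₀) ⊕ r x₂ y₃ z₃) ⊖ r x₃ y₂ z₂)
    , (((r x₀ y₂ z₂ ⊖ r x₁ y₃ z₃) ⊕ r x₂ y₀ z₀) ⊕ r x₃ y₁ z₁)
    , (((r x₀ y₃ z₃ ⊕ r x₁ y₂ z₂) ⊖ r x₂ y₁ z₁) ⊕ r x₃ y₀ z₀)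
    where
    r : ∀ x y z → x * (a * y + b * z) ≈ a * (x * y) + b * (x * z)
    r = S.*-linearʳ a b

  ·H-identityˡ : ∀ X → (1# ·H X) ≈H X
  ·H-identityˡ (quat x₀ x₁ x₂ x₃) =
    *-identityˡ x₀ , *-identityˡ x₁ , *-identityˡ x₂ , *-identityˡ x₃

  ·H-assoc : ∀ a b X → (a ·H (b ·H X)) ≈H ((a * b) ·H X)
  ·H-assoc a b (quat x₀ x₁ x₂ x₃) =
    sym (*-assoc a b x₀) , sym (*-assoc a b x₁) , sym (*-assoc a b x₂) , sym (*-assoc a b x₃)

  unit-combination : ∀ t X Y → (1# ·H X +H (t * 0#) ·H Y) ≈H X
  unit-combination t (quat x₀ x₁ x₂ x₃) (quat y₀ y₁ y₂ y₃) =
    S.unit-combination t x₀ y₀ , S.unit-combination t x₁ y₁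
    , S.unit-combination t x₂ y₂ , S.unit-combination t x₃ y₃

  combination-step : ∀ a b p q X Y →
    (a ·H (p ·H X +H q ·H Y) +H (q * b) ·H X) ≈H ((p * a + q * b) ·H X +H (q * a) ·H Y)
  combination-step a b p q (quat x₀ x₁ x₂ x₃) (quat y₀ y₁ y₂ y₃) =
    law x₀ y₀ , law x₁ y₁ , law x₂ y₂ , law x₃ y₃
    where
    law : ∀ x y → a * (p * x + q * y) + (q * b) * x ≈ (p * a + q * b) * x + (q * a) * y
    law = S.combination-step a b p q

  cancel-first : ∀ a b P Q R →
    ((a ·H P +H b ·H Q) -H (a ·H P +H b ·H R)) ≈H ((- b) ·H (R -H Q))
  cancel-first a b (quat P₀ P₁ P₂ P₃) (quat Q₀ Q₁ Q₂ Q₃) (quat R₀ R₁ R₂ R₃) =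
    law P₀ Q₀ R₀ , law P₁ Q₁ R₁ , law P₂ Q₂ R₂ , law P₃ Q₃ R₃
    where
    law : ∀ P Q R → (a * P + b * Q) - (a * P + b * R) ≈ (- b) * (R - Q)
    law = S.cancel-first a b

  cancel-second : ∀ a b P Q R →
    ((a ·H P +H b ·H Q) -H (a ·H R +H b ·H Q)) ≈H (a ·H (P -H R))
  cancel-second a b (quat P₀ P₁ P₂ P₃) (quat Q₀ Q₁ Q₂ Q₃) (quat R₀ R₁ R₂ R₃) =
    law P₀ Q₀ R₀ , law P₁ Q₁ R₁ , law P₂ Q₂ R₂ , law P₃ Q₃ R₃
    where
    law : ∀ P Q R → (a * P + b * Q) - (a * R + b * Q) ≈ a * (P - R)
    law = S.cancel-second a b

-- Natural-number addition is opened only here, after the ring-level modules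
-- whose _+_ is the ring addition.
open import Data.Nat using (ℕ; zero; suc; _+_; _≤_)

module RecurrentSequences {c ℓ} (R : CommutativeRing c ℓ) (p q : CommutativeRing.Carrier R) where
  open CommutativeRing R using (Carrier; _*_; -_; 1#; 0#; *-comm)
    renaming (refl to ≈-refl)
  open Quat R
  open QuaternionAlgebra R
  open Setoid ≈H-setoid using (refl; sym)
  open import Relation.Binary.Reasoning.Setoid ≈H-setoid

  u : ℕ → Carrier
  u = fib p q

  IsHoradam : (ℕ → H) → Set ℓ
  IsHoradam Z = ∀ n → Z (suc (suc n)) ≈H (p ·H Z (suc n) +H q ·H Z n)

  horadamQ-isHoradam : ∀ w0 w1 → IsHoradam (horadamQ w0 w1 p q)
  horadamQ-isHoradam w0 w1 n = refl

  shift : ∀ {Z} → IsHoradam Z → ∀ r m →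
    Z (m + suc r) ≈H (u (suc r) ·H Z (suc m) +H (q * u r) ·H Z m)
  shift {Z} recZ zero m = begin
    Z (m + 1)                           ≡⟨ cong Z (ℕ.+-comm m 1) ⟩
    Z (suc m)                           ≈⟨ unit-combination q (Z (suc m)) (Z m) ⟨
    1# ·H Z (suc m) +H (q * 0#) ·H Z m  ∎
  shift {Z} recZ (suc r) m = begin
    Z (m + suc (suc r))                                           ≡⟨ cong Z (ℕ.+-suc m (suc r)) ⟩
    Z (suc m + suc r)                                             ≈⟨ shift recZ r (suc m) ⟩
    u (suc r) ·H Z (suc (suc m)) +H (q * u r) ·H Z (suc m)
      ≈⟨ +H-cong (·H-cong ≈-refl (recZ m)) refl ⟩
    u (suc r) ·H (p ·H Z (suc m) +H q ·H Z m) +H (q * u r) ·H Z (suc m)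
      ≈⟨ combination-step (u (suc r)) (u r) p q (Z (suc m)) (Z m) ⟩
    u (suc (suc r)) ·H Z (suc m) +H (q * u (suc r)) ·H Z m        ∎

  casoratian : (X Y : ℕ → H) (s n : ℕ) → H
  casoratian X Y s n = X (suc n) *H Y (n + s) -H X n *H Y (suc (n + s))

  casoratian-step : ∀ {X Y} → IsHoradam X → IsHoradam Y → ∀ s n →
    casoratian X Y s (suc n) ≈H ((- q) ·H casoratian X Y s n)
  casoratian-step {X} {Y} recX recY s n = begin
    X₂ *H Y₁ -H X₁ *H Y (suc (suc (n + s)))
      ≈⟨ -H-cong (*H-cong (recX n) refl) (*H-cong refl (recY (n + s))) ⟩
    (p ·H X₁ +H q ·H X₀) *H Y₁ -H X₁ *H (p ·H Y₁ +H q ·H Y₀)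
      ≈⟨ -H-cong (*H-linearˡ p q X₁ X₀ Y₁) (*H-linearʳ p q X₁ Y₁ Y₀) ⟩
    (p ·H (X₁ *H Y₁) +H q ·H (X₀ *H Y₁)) -H (p ·H (X₁ *H Y₁) +H q ·H (X₁ *H Y₀))
      ≈⟨ cancel-first p q (X₁ *H Y₁) (X₀ *H Y₁) (X₁ *H Y₀) ⟩
    (- q) ·H (X₁ *H Y₀ -H X₀ *H Y₁)
      ∎
    where
    X₂ X₁ X₀ Y₁ Y₀ : H
    X₂ = X (suc (suc n)); X₁ = X (suc n); X₀ = X n
    Y₁ = Y (suc (n + s)); Y₀ = Y (n + s)

  casoratian-closed : ∀ {X Y} → IsHoradam X → IsHoradam Y → ∀ s n →
    casoratian X Y s n ≈H (pow (- q) n ·H casoratian X Y s 0)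
  casoratian-closed recX recY s zero = sym (·H-identityˡ _)
  casoratian-closed {X} {Y} recX recY s (suc n) = begin
    casoratian X Y s (suc n)                           ≈⟨ casoratian-step recX recY s n ⟩
    (- q) ·H casoratian X Y s n                        ≈⟨ ·H-cong ≈-refl (casoratian-closed recX recY s n) ⟩
    (- q) ·H (pow (- q) n ·H casoratian X Y s 0)       ≈⟨ ·H-assoc (- q) (pow (- q) n) _ ⟩
    pow (- q) (suc n) ·H casoratian X Y s 0            ∎

  difference-as-casoratian : ∀ {X Y} → IsHoradam X → IsHoradam Y → ∀ n r s →
    (X (n + suc r) *H Y (n + s) -H X n *H Y (n + suc r + s))
      ≈H (u (suc r) ·H casoratian X Y s n)
  difference-as-casoratian {X} {Y} recX recY n r s = begin
    X (n + suc r) *H Y₀ -H X₀ *H Y (n + suc r + s)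
      ≡⟨ cong (λ k → X (n + suc r) *H Y₀ -H X₀ *H Y k) (ℕ-+.xy∙z≈xz∙y n (suc r) s) ⟩
    X (n + suc r) *H Y₀ -H X₀ *H Y (n + s + suc r)
      ≈⟨ -H-cong (*H-cong (shift recX r n) refl) (*H-cong refl (shift recY r (n + s))) ⟩
    (a ·H X₁ +H b ·H X₀) *H Y₀ -H X₀ *H (a ·H Y₁ +H b ·H Y₀)
      ≈⟨ -H-cong (*H-linearˡ a b X₁ X₀ Y₀) (*H-linearʳ a b X₀ Y₁ Y₀) ⟩
    (a ·H (X₁ *H Y₀) +H b ·H (X₀ *H Y₀)) -H (a ·H (X₀ *H Y₁) +H b ·H (X₀ *H Y₀))
      ≈⟨ cancel-second a b (X₁ *H Y₀) (X₀ *H Y₀) (X₀ *H Y₁) ⟩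
    a ·H casoratian X Y s n
      ∎
    where
    module ℕ-+ = CommSemigroupProperties ℕ.+-commutativeSemigroup
    a b : Carrier
    a = u (suc r); b = q * u r
    X₁ X₀ Y₁ Y₀ : H
    X₁ = X (suc n); X₀ = X n
    Y₁ = Y (suc (n + s)); Y₀ = Y (n + s)

  vajda : ∀ {X Y} → IsHoradam X → IsHoradam Y → ∀ n r s →
    (X (n + suc r) *H Y (n + s) -H X n *H Y (n + suc r + s))
      ≈H ((pow (- q) n * u (suc r)) ·H (X 1 *H Y s -H X 0 *H Y (s + 1)))
  vajda {X} {Y} recX recY n r s = begin
    X (n + suc r) *H Y (n + s) -H X n *H Y (n + suc r + s)
      ≈⟨ difference-as-casoratian recX recY n r s ⟩
    u (suc r) ·H casoratian X Y s n
      ≈⟨ ·H-cong ≈-refl (casoratian-closed recX recY s n) ⟩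
    u (suc r) ·H (pow (- q) n ·H casoratian X Y s 0)
      ≈⟨ ·H-assoc (u (suc r)) (pow (- q) n) _ ⟩
    (u (suc r) * pow (- q) n) ·H casoratian X Y s 0
      ≈⟨ ·H-cong (*-comm (u (suc r)) (pow (- q) n)) refl ⟩
    (pow (- q) n * u (suc r)) ·H (X 1 *H Y s -H X 0 *H Y (suc s))
      ≡⟨ cong (λ k → (pow (- q) n * u (suc r)) ·H (X 1 *H Y s -H X 0 *H Y k)) (ℕ.+-comm 1 s) ⟩
    (pow (- q) n * u (suc r)) ·H (X 1 *H Y s -H X 0 *H Y (s + 1))
      ∎

corollary2p3 : ∀ {c ℓ : Level} (R : CommutativeRing c ℓ) →
    let open Quat R
    in (p q w0 w1 : CommutativeRing.Carrier R) (n r s : ℕ) → 1 ≤ n → 1 ≤ r → 1 ≤ s →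
      let u = fib p q
          U = fibQ p q
          W = horadamQ w0 w1 p q
          k = CommutativeRing._*_ R (pow (CommutativeRing.-_ R q) n) (u r)
      in ((U (n + r) *H U (n + s) -H U n *H U (n + r + s))
            ≈H (k ·H (U 1 *H U s -H U 0 *H U (s + 1))))
       × ((U (n + r) *H W (n + s) -H U n *H W (n + r + s))
            ≈H (k ·H (U 1 *H W s -H U 0 *H W (s + 1))))
       × ((W (n + r) *H U (n + s) -H W n *H U (n + r + s))
            ≈H (k ·H (W 1 *H U s -H W 0 *H U (s + 1))))
       × ((W (n + r) *H W (n + s) -H W n *H W (n + r + s))
            ≈H (k ·H (W 1 *H W s -H W 0 *H W (s + 1))))
corollary2p3 R p q w0 w1 n zero s _ () _
corollary2p3 R p q w0 w1 n (suc r) s _ _ _ =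
  vajda Uᴴ Uᴴ n r s , vajda Uᴴ Wᴴ n r s , vajda Wᴴ Uᴴ n r s , vajda Wᴴ Wᴴ n r s
  where
  open CommutativeRing R using (0#; 1#)
  open Quat R using (fibQ; horadamQ)
  open RecurrentSequences R p q
  Uᴴ : IsHoradam (fibQ p q)
  Uᴴ = horadamQ-isHoradam 0# 1#
  Wᴴ : IsHoradam (horadamQ w0 w1 p q)
  Wᴴ = horadamQ-isHoradam w0 w1
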